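{- Let $k\in[n]$ and let $S\in\mathcal{R}_\pi$ be such that $S$ contains an element of $E_k$ (i.e. $k\in\underline{S}$). Then $h_{\{k^j\}}\cdot x_S=0$ in $A^*(\Sigma^\pi)$ for every $j\in\mathbb{Z}_r$.
   Context: Uniform setting: $r\ge2$, $E=\bigsqcup_{i=1}^nE_i$ with $E_i=\{i^0,i^1,\ldots,i^{r-1}\}$. A subset is colored if it meets each $E_i$ in at most one element; $\mathcal{R}_\pi$ is the set of colored subsets, $\mathcal{R}_\pi^\times$ the nonempty ones; $\underline{S}\subseteq[n]$ is the set of $i$ with $S\cap E_i\ne\emptyset$. $A^*(\Sigma^\pi)=\mathbb{Z}[x_S:S\in\mathcal{R}_\pi^\times]/(\mathcal{I}+\mathcal{J})$ with $\mathcal{I}$ generated by $x_Sx_{S'}$ for incomparable $S,S'$ and $\mathcal{J}$ by $\sum_{S\ni e}x_S-\sum_{S\ni e'}x_S$ for distinct $e,e'$ in a common block; $x_\emptyset=0$; $h_U=\sum_{S'\in\mathcal{R}_\pi^\times,\,S'\cap U\ne\emptyset}x_{S'}$. (The paper states this in $A^*(\overline{\mathcal{L}}^r_n)$, which it identifies with $A^*(\Sigma^\pi)$.) -}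

module Defs where

open import Level using (Level)
open import Data.Nat using (ℕ; zero; suc)
open import Data.Fin using (Fin)
import Data.Fin as F
open import Data.Maybe using (Maybe; just; nothing)
open import Data.Bool using (Bool; true; false; if_then_else_)
open import Data.List using (List; []; _∷_; [_]; map; concatMap; allFin; foldr)
open import Data.Vec using (Vec; []; _∷_; lookup; replicate)
open import Data.Product using (_×_; _,_; ∃)
open import Relation.Binary.PropositionalEquality using (_≡_)
open import Relation.Nullary using (¬_; does)
open import Algebra.Bundles using (CommutativeRing)

-- A colored subset of E = ⊔_{i<n} E_i, |E_i| = r : for each block i it records
-- either nothing (S ∩ E_i = ∅) or the unique j with i^j ∈ S.
Colored : ℕ → ℕ → Set
Colored n r = Vec (Maybe (Fin r)) n

-- Elements of E: i^j is (i , j).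
Elem : ℕ → ℕ → Set
Elem n r = Fin n × Fin r

emptyC : ∀ {n r} → Colored n r
emptyC {n} = replicate n nothing

_∈C_ : ∀ {n r} → Elem n r → Colored n r → Set
(i , j) ∈C S = lookup S i ≡ just j

_⊆C_ : ∀ {n r} → Colored n r → Colored n r → Set
S ⊆C S' = ∀ e → e ∈C S → e ∈C S'

Incomparable : ∀ {n r} → Colored n r → Colored n r → Set
Incomparable S S' = ¬ (S ⊆C S') × ¬ (S' ⊆C S)

memb : ∀ {n r} → Elem n r → Colored n r → Bool
memb (i , j) S with lookup S i
... | nothing = false
... | just j' = does (j F.≟ j')

allVecs : ∀ {A : Set} (n : ℕ) → List A → List (Vec A n)
allVecs zero xs = [ [] ]
allVecs (suc n) xs = concatMap (λ v → map (λ x → x ∷ v) xs) (allVecs n xs)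

-- the list of all colored subsets (R_π), each exactly once
allColored : (n r : ℕ) → List (Colored n r)
allColored n r = allVecs n (nothing ∷ map just (allFin r))

module _ {c ℓ : Level} (R : CommutativeRing c ℓ) where
  open CommutativeRing R

  sumContaining : ∀ {n r} → (Colored n r → Carrier) → Elem n r → Carrier
  sumContaining {n} {r} a e =
    foldr (λ S acc → (if memb e S then a S else 0#) + acc) 0# (allColored n r)

  -- h_{{e}} = Σ_{S' ∈ R_π^×, S' ∩ {e} ≠ ∅} x_{S'}  (those S' are exactly the S' ∋ e)
  hSingle : ∀ {n r} → (Colored n r → Carrier) → Elem n r → Carrier
  hSingle a e = sumContaining a e

  -- a family (a_S) in R satisfies the defining relations of A*(Σ^π):
  -- x_∅ = 0, the generators of 𝓘 and of 𝓙.
  record SatisfiesRelations {n r : ℕ} (a : Colored n r → Carrier) : Set (c Level.⊔ ℓ) where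
    field
      empty≈0 : a emptyC ≈ 0#
      relI : ∀ S S' → Incomparable S S' → a S * a S' ≈ 0#
      relJ : ∀ (i : Fin n) (j j' : Fin r) → ¬ (j ≡ j') →
             sumContaining a (i , j) ≈ sumContaining a (i , j')

{-# OPTIONS --safe #-}
module Submission where

-- If S contains k^j₀, then every S' containing k^j with j ≠ j₀ is
-- incomparable with S (they meet E_k in different elements), so each summand
-- x_{S'} x_S of h_{k^j} x_S is a generator of 𝓘. For j = j₀ the linear
-- relation 𝓙 first replaces h_{k^j₀} by h_{k^j'} for some other colour j',
-- which exists because r ≥ 2.

open import Defs
open import Level using (Level)
open import Data.Nat using (ℕ; _≥_; s≤s; z≤n)
open import Data.Fin using (Fin; zero; suc; _≟_)
open import Data.Product using (∃; _,_)
open import Data.Maybe using (just)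
open import Data.Maybe.Properties using (just-injective)
open import Data.Bool using (true; false; if_then_else_)
open import Data.Vec using (lookup)
open import Data.List using ([]; _∷_; foldr)
open import Relation.Binary.PropositionalEquality using (_≡_; refl; sym; trans; _≢_; ≢-sym)
open import Relation.Nullary using (yes; no)
open import Algebra.Bundles using (CommutativeRing)
import Relation.Binary.Reasoning.Setoid as SetoidReasoning

memb⇒∈C : ∀ {n r} (e : Elem n r) (S : Colored n r) → memb e S ≡ true → e ∈C S
memb⇒∈C (i , j) S eq with lookup S i
... | just j' with j ≟ j'
...   | yes refl = refl

∈C-colour-unique : ∀ {n r} {i : Fin n} {j j' : Fin r} {S : Colored n r} →
  (i , j) ∈C S → (i , j') ∈C S → j ≡ j'
∈C-colour-unique i^j∈S i^j'∈S = just-injective (trans (sym i^j∈S) i^j'∈S)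

distinct-colours⇒incomparable : ∀ {n r} {i : Fin n} {j j' : Fin r} (S S' : Colored n r) →
  j ≢ j' → (i , j) ∈C S → (i , j') ∈C S' → Incomparable S S'
distinct-colours⇒incomparable S S' j≢j' i^j∈S i^j'∈S' =
    (λ S⊆S' → j≢j' (∈C-colour-unique {S = S'} (S⊆S' _ i^j∈S) i^j'∈S'))
  , (λ S'⊆S → j≢j' (∈C-colour-unique {S = S} i^j∈S (S'⊆S _ i^j'∈S')))

another-colour : ∀ {r} → r ≥ 2 → (j : Fin r) → ∃ λ j' → j' ≢ j
another-colour (s≤s (s≤s z≤n)) zero    = suc zero , λ ()
another-colour (s≤s (s≤s z≤n)) (suc j) = zero , λ ()

module _ {c ℓ : Level} (R : CommutativeRing c ℓ) where
  open CommutativeRing R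
  open SetoidReasoning setoid

  foldr-sum-*-annihilated : ∀ {A : Set} (f : A → Carrier) (b : Carrier) →
    (∀ x → f x * b ≈ 0#) → ∀ xs → foldr (λ x acc → f x + acc) 0# xs * b ≈ 0#
  foldr-sum-*-annihilated f b fb≈0 []       = zeroˡ b
  foldr-sum-*-annihilated f b fb≈0 (x ∷ xs) = begin
    (f x + foldr (λ x acc → f x + acc) 0# xs) * b      ≈⟨ distribʳ b _ _ ⟩
    f x * b + foldr (λ x acc → f x + acc) 0# xs * b    ≈⟨ +-cong (fb≈0 x) (foldr-sum-*-annihilated f b fb≈0 xs) ⟩
    0# + 0#                                            ≈⟨ +-identityˡ 0# ⟩
    0#                                                 ∎

  sumContaining-*-annihilated : ∀ {n r} (a : Colored n r → Carrier) (e : Elem n r) (b : Carrier) →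
    (∀ S → e ∈C S → a S * b ≈ 0#) → sumContaining R a e * b ≈ 0#
  sumContaining-*-annihilated {n} {r} a e b annihilates =
    foldr-sum-*-annihilated summand b summand*b≈0 (allColored n r)
    where
    summand : Colored n r → Carrier
    summand S = if memb e S then a S else 0#

    summand*b≈0 : ∀ S → summand S * b ≈ 0#
    summand*b≈0 S with memb e S in e∈S
    ... | true  = annihilates S (memb⇒∈C e S e∈S)
    ... | false = zeroˡ b

  module _ {n r : ℕ} {a : Colored n r → Carrier} (sat : SatisfiesRelations R a) where
    open SatisfiesRelations sat

    hSingle-other-colour-*≈0 : ∀ {k : Fin n} {j j₀ : Fin r} (S : Colored n r) →
      j ≢ j₀ → (k , j₀) ∈C S → hSingle R a (k , j) * a S ≈ 0#
    hSingle-other-colour-*≈0 S j≢j₀ k^j₀∈S = sumContaining-*-annihilated a _ _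
      λ S' k^j∈S' → relI S' S (distinct-colours⇒incomparable S' S j≢j₀ k^j∈S' k^j₀∈S)

lemma6p4 : ∀ {c ℓ : Level} (n r : ℕ) → r ≥ 2 →
    (R : CommutativeRing c ℓ) →
    (a : Colored n r → CommutativeRing.Carrier R) →
    SatisfiesRelations R a →
    (k : Fin n) (S : Colored n r) →
    ∃ (λ j₀ → (k , j₀) ∈C S) →
    (j : Fin r) →
    CommutativeRing._≈_ R
      (CommutativeRing._*_ R (hSingle R a (k , j)) (a S))
      (CommutativeRing.0# R)
lemma6p4 n r r≥2 R a sat k S (j₀ , k^j₀∈S) j with j ≟ j₀ | another-colour r≥2 j
... | no j≢j₀  | _          = hSingle-other-colour-*≈0 R sat S j≢j₀ k^j₀∈S
... | yes refl | j' , j'≢j = begin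
    hSingle R a (k , j) * a S    ≈⟨ *-congʳ (relJ k j j' (≢-sym j'≢j)) ⟩
    hSingle R a (k , j') * a S   ≈⟨ hSingle-other-colour-*≈0 R sat S j'≢j k^j₀∈S ⟩
    0#                           ∎
  where
  open CommutativeRing R using (_*_; 0#; *-congʳ; setoid)
  open SetoidReasoning setoid
  open SatisfiesRelations sat using (relJ)
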